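{- The diameter of the cyclic Kautz digraph $CK(2,4)$ is $7$, and the diameter of $CK(2,3)$ and of $CK(2,\ell)$ for every $\ell\ge 5$ is infinite.
   Context: $CK(2,\ell)$ has as vertices all words $a_1\ldots a_\ell$ over an alphabet of $3$ symbols with $a_i\ne a_{i+1}$ for $1\le i\le\ell-1$ and $a_1\ne a_\ell$, and an arc from $a_1a_2\ldots a_\ell$ to $a_2\ldots a_\ell a_{\ell+1}$ whenever both words are vertices. The diameter is the maximum over ordered pairs of vertices of the directed distance, infinite if some vertex is unreachable from another. -}

module Defs where

open import Data.Nat using (ℕ; zero; suc; _≤_; _<_)
open import Data.Fin using (Fin)
open import Data.Vec using (Vec; []; _∷_; head; last; init)
open import Data.Product using (_×_; ∃-syntax)
open import Data.Empty using (⊥)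
open import Data.Unit using (⊤)
open import Relation.Nullary using (¬_)
open import Relation.Binary.PropositionalEquality using (_≡_; _≢_)

Word : ℕ → Set
Word ℓ = Vec (Fin 3) ℓ

ConsecDistinct : ∀ {n} → Word n → Set
ConsecDistinct [] = ⊤
ConsecDistinct (x ∷ []) = ⊤
ConsecDistinct (x ∷ y ∷ xs) = (x ≢ y) × ConsecDistinct (y ∷ xs)

-- Vertices of CK(2,ℓ): consecutive letters distinct and a_1 ≠ a_ℓ.
-- (For ℓ = 0 there are no vertices; the statement only concerns ℓ ≥ 3.)
IsVertex : ∀ {ℓ} → Word ℓ → Set
IsVertex [] = ⊥
IsVertex w@(_ ∷ _) = ConsecDistinct w × (head w ≢ last w)

-- Arc a_1 a_2 … a_ℓ → a_2 … a_ℓ a_{ℓ+1}, both words being vertices: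
-- i.e. v's first ℓ-1 letters are u's last ℓ-1 letters.
Arc : ∀ {ℓ} → Word ℓ → Word ℓ → Set
Arc [] [] = ⊥
Arc u@(_ ∷ as) v = IsVertex u × IsVertex v × (as ≡ init v)

data Walk {ℓ : ℕ} : Word ℓ → Word ℓ → ℕ → Set where
  here : ∀ {u} → Walk u u 0
  step : ∀ {u w v k} → Arc u w → Walk w v k → Walk u v (suc k)

Dist : ∀ {ℓ} → Word ℓ → Word ℓ → ℕ → Set
Dist u v d = Walk u v d × (∀ k → k < d → ¬ Walk u v k)

DiameterIs : ℕ → ℕ → Set
DiameterIs ℓ d =
  (∀ (u v : Word ℓ) → IsVertex u → IsVertex v → ∃[ k ] (k ≤ d × Walk u v k))
  × (∃[ u ] ∃[ v ] (IsVertex u × IsVertex v × Dist {ℓ} u v d))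

DiameterInfinite : ℕ → Set
DiameterInfinite ℓ =
  ∃[ u ] ∃[ v ] (IsVertex {ℓ} u × IsVertex {ℓ} v × (∀ k → ¬ Walk u v k))

-- Give each step x → y of a word the turn +1 if y = x + 1 (mod 3) and -1 otherwise, and
-- call the sum of the turns the winding of the word.  The winding is ≡ last - first
-- (mod 3), so the winding of a vertex is never ≡ 0 (mod 3).  An arc drops the first
-- turn d₁ and appends a new one d₂, taking d₁ + t to t + d₂; from d₁ + t ≥ 2 the only
-- ways to reach t + d₂ < 2 pass through d₁ + t = 3 or t + d₂ = 0, both excluded.  So
-- "winding ≥ 2" is invariant along walks, and CK(2,ℓ) is not strongly connected as soon
-- as it has vertices on both sides of this threshold: 012 / 021 for ℓ = 3, 012012 /
-- 012021 for ℓ = 6, and inserting x+1, x after a leading x goes from ℓ to ℓ + 2 without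
-- changing the winding.  For ℓ = 4 the diameter is computed by exhaustive search.

module Submission where

open import Defs
open import Data.Nat as ℕ using (ℕ; zero; suc; _≤_; z≤n; s≤s)
open import Data.Nat.Properties using (anyUpTo?; allUpTo?; m<1+n⇒m≤n; m≤n⇒∃[o]m+o≡n)
open import Data.Fin using (Fin; _≟_)
open import Data.Fin.Patterns using (0F; 1F; 2F)
open import Data.Fin.Properties using (all?; any?)
open import Data.Vec using (Vec; []; _∷_; init; last; _∷ʳ_; initLast)
open import Data.Vec.Properties using (≡-dec)
open import Data.Integer as ℤ using (ℤ; +_; -[1+_]; _+_; _◃_; 0ℤ; 1ℤ; -1ℤ; +≤+)
open import Data.Integer.Properties using (+-assoc; +-identityˡ; +-identityʳ)
open import Data.Sign using (Sign)
open import Data.Unit using (tt)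
open import Data.Product using (_×_; _,_; proj₂; ∃-syntax)
open import Data.Empty using (⊥-elim)
open import Function using (id; _∘_)
open import Relation.Nullary using (¬_; Dec; yes; no)
open import Relation.Nullary.Decidable using (from-yes; map′; ¬?; _×-dec_; _→-dec_)
open import Relation.Binary.PropositionalEquality
  using (_≡_; _≢_; refl; sym; trans; cong; cong₂; subst; module ≡-Reasoning)

suc₃ pred₃ : Fin 3 → Fin 3
suc₃ 0F = 1F
suc₃ 1F = 2F
suc₃ 2F = 0F
pred₃ 0F = 2F
pred₃ 1F = 0F
pred₃ 2F = 1F

suc₃-pred₃ : ∀ x → suc₃ (pred₃ x) ≡ x
suc₃-pred₃ 0F = refl
suc₃-pred₃ 1F = refl
suc₃-pred₃ 2F = refl

pred₃-suc₃ : ∀ x → pred₃ (suc₃ x) ≡ x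
pred₃-suc₃ 0F = refl
pred₃-suc₃ 1F = refl
pred₃-suc₃ 2F = refl

rotate : Sign → Fin 3 → Fin 3
rotate Sign.+ = suc₃
rotate Sign.- = pred₃

_-₃_ : Fin 3 → Fin 3 → Fin 3
x -₃ 0F = x
x -₃ 1F = pred₃ x
x -₃ 2F = suc₃ x

mod₃ : ℤ → Fin 3
mod₃ (+ zero)     = 0F
mod₃ (+ suc n)    = suc₃ (mod₃ (+ n))
mod₃ -[1+ zero ]  = 2F
mod₃ -[1+ suc n ] = pred₃ (mod₃ -[1+ n ])

mod₃-◃1+ : ∀ s t → mod₃ ((s ◃ 1) + t) ≡ rotate s (mod₃ t)
mod₃-◃1+ Sign.+ (+ n)        = refl
mod₃-◃1+ Sign.+ -[1+ zero ]  = refl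
mod₃-◃1+ Sign.+ -[1+ suc n ] = sym (suc₃-pred₃ _)
mod₃-◃1+ Sign.- (+ zero)     = refl
mod₃-◃1+ Sign.- (+ suc n)    = sym (pred₃-suc₃ _)
mod₃-◃1+ Sign.- -[1+ n ]     = refl

orientation : Fin 3 → Fin 3 → Sign
orientation 0F 1F = Sign.+
orientation 1F 2F = Sign.+
orientation 2F 0F = Sign.+
orientation _  _  = Sign.-

turn : Fin 3 → Fin 3 → ℤ
turn x y = orientation x y ◃ 1

winding : ∀ {n} → Word n → ℤ
winding []           = 0ℤ
winding (x ∷ [])     = 0ℤ
winding (x ∷ y ∷ ys) = turn x y + winding (y ∷ ys)

-₃-self : ∀ x → x -₃ x ≡ 0F
-₃-self = from-yes (all? λ x → x -₃ x ≟ 0F)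

-₃≡0F⇒≡ : ∀ x y → x -₃ y ≡ 0F → y ≡ x
-₃≡0F⇒≡ = from-yes (all? λ x → all? λ y → (x -₃ y ≟ 0F) →-dec (y ≟ x))

rotate-orientation : ∀ x y z → x ≢ y → rotate (orientation x y) (z -₃ y) ≡ z -₃ x
rotate-orientation = from-yes (all? λ x → all? λ y → all? λ z →
  ¬? (x ≟ y) →-dec (rotate (orientation x y) (z -₃ y) ≟ z -₃ x))

mod₃-winding : ∀ {n} x (xs : Vec (Fin 3) n) → ConsecDistinct (x ∷ xs) →
               mod₃ (winding (x ∷ xs)) ≡ last (x ∷ xs) -₃ x
mod₃-winding x []       _                 = sym (-₃-self x)
mod₃-winding x (y ∷ ys) (x≢y , distinct) = begin
  mod₃ (turn x y + winding (y ∷ ys))                   ≡⟨ mod₃-◃1+ (orientation x y) _ ⟩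
  rotate (orientation x y) (mod₃ (winding (y ∷ ys)))   ≡⟨ cong (rotate (orientation x y)) (mod₃-winding y ys distinct) ⟩
  rotate (orientation x y) (last (y ∷ ys) -₃ y)        ≡⟨ rotate-orientation x y _ x≢y ⟩
  last (y ∷ ys) -₃ x                                   ∎
  where open ≡-Reasoning

vertex⇒mod₃-winding≢0 : ∀ {n} (w : Word n) → IsVertex w → mod₃ (winding w) ≢ 0F
vertex⇒mod₃-winding≢0 (x ∷ xs) (distinct , x≢last) ≡0 =
  x≢last (-₃≡0F⇒≡ _ x (trans (sym (mod₃-winding x xs distinct)) ≡0))

HighWinding : ∀ {n} → Word n → Set
HighWinding w = + 2 ℤ.≤ winding w

winding-shift : ∀ s₁ s₂ t → mod₃ ((s₁ ◃ 1) + t) ≢ 0F → mod₃ (t + (s₂ ◃ 1)) ≢ 0F →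
                + 2 ℤ.≤ (s₁ ◃ 1) + t → + 2 ℤ.≤ t + (s₂ ◃ 1)
winding-shift _      Sign.+ (+ suc (suc (suc n))) _  _  _ = +≤+ (s≤s (s≤s z≤n))
winding-shift _      Sign.- (+ suc (suc (suc n))) _  _  _ = +≤+ (s≤s (s≤s z≤n))
winding-shift Sign.+ Sign.+ (+ 1)                 _  _  _ = +≤+ (s≤s (s≤s z≤n))
winding-shift Sign.+ Sign.+ (+ 2)                 _  _  _ = +≤+ (s≤s (s≤s z≤n))
winding-shift Sign.+ Sign.- (+ 1)                 _  ≢0 _ = ⊥-elim (≢0 refl)
winding-shift Sign.+ Sign.- (+ 2)                 ≢0 _  _ = ⊥-elim (≢0 refl)
winding-shift Sign.+ _      (+ 0)                 _  _  (+≤+ (s≤s ()))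
winding-shift Sign.+ _      -[1+ 0 ]              _  _  (+≤+ ())
winding-shift Sign.+ _      -[1+ suc n ]          _  _  ()
winding-shift Sign.- _      (+ 0)                 _  _  ()
winding-shift Sign.- _      (+ 1)                 _  _  (+≤+ ())
winding-shift Sign.- _      (+ 2)                 _  _  (+≤+ (s≤s ()))
winding-shift Sign.- _      -[1+ n ]              _  _  ()

winding-∷ʳ : ∀ {n} (w : Word (suc n)) x → winding (w ∷ʳ x) ≡ winding w + turn (last w) x
winding-∷ʳ (y ∷ [])     x = trans (+-identityʳ (turn y x)) (sym (+-identityˡ (turn y x)))
winding-∷ʳ (y ∷ z ∷ zs) x =
  trans (cong (λ t → turn y z + t) (winding-∷ʳ (z ∷ zs) x))
        (sym (+-assoc (turn y z) (winding (z ∷ zs)) (turn (last (z ∷ zs)) x)))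

arc-target : ∀ {n a} {as : Word n} {w} → Arc (a ∷ as) w → w ≡ as ∷ʳ last w
arc-target {w = w} (_ , _ , refl) = proj₂ (proj₂ (initLast w))

highWinding-shift : ∀ {n} a (as : Word (suc n)) x → IsVertex (a ∷ as) → IsVertex (as ∷ʳ x) →
                    HighWinding (a ∷ as) → HighWinding (as ∷ʳ x)
highWinding-shift a as@(y ∷ _) x u-vertex w-vertex =
  subst (+ 2 ℤ.≤_) (sym (winding-∷ʳ as x))
  ∘ winding-shift (orientation a y) (orientation (last as) x) (winding as)
      (vertex⇒mod₃-winding≢0 (a ∷ as) u-vertex)
      (subst (λ t → mod₃ t ≢ 0F) (winding-∷ʳ as x) (vertex⇒mod₃-winding≢0 (as ∷ʳ x) w-vertex))

highWinding-arc : ∀ {n} {u w : Word (2 ℕ.+ n)} → Arc u w → HighWinding u → HighWinding w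
highWinding-arc {u = a ∷ as} {w} arc@(u-vertex , w-vertex , _) =
  subst HighWinding (sym (arc-target arc))
  ∘ highWinding-shift a as (last w) u-vertex (subst IsVertex (arc-target arc) w-vertex)

highWinding-walk : ∀ {n k} {u v : Word (2 ℕ.+ n)} → Walk u v k → HighWinding u → HighWinding v
highWinding-walk here            = id
highWinding-walk (step arc walk) = highWinding-walk walk ∘ highWinding-arc arc

Separated : ℕ → Set
Separated ℓ = ∃[ u ] ∃[ v ] (IsVertex {ℓ} u × IsVertex {ℓ} v × HighWinding u × ¬ HighWinding v)

separated⇒diameterInfinite : ∀ {n} → Separated (2 ℕ.+ n) → DiameterInfinite (2 ℕ.+ n)
separated⇒diameterInfinite (u , v , u-vertex , v-vertex , u-high , v-low) =
  u , v , u-vertex , v-vertex , λ _ walk → v-low (highWinding-walk walk u-high)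

pad : ∀ {n} → Word (suc n) → Word (3 ℕ.+ n)
pad (x ∷ xs) = x ∷ suc₃ x ∷ x ∷ xs

pad-vertex : ∀ {n} (w : Word (suc n)) → IsVertex w → IsVertex (pad w)
pad-vertex (x ∷ xs) (distinct , x≢last) = (x≢suc₃x x , x≢suc₃x x ∘ sym , distinct) , x≢last
  where
  x≢suc₃x : ∀ x → x ≢ suc₃ x
  x≢suc₃x = from-yes (all? λ x → ¬? (x ≟ suc₃ x))

winding-pad : ∀ {n} (w : Word (suc n)) → winding (pad w) ≡ winding w
winding-pad (x ∷ xs) = begin
  turn x (suc₃ x) + (turn (suc₃ x) x + winding (x ∷ xs)) ≡⟨ cong₂ (λ a b → a + (b + winding (x ∷ xs))) (up x) (down x) ⟩
  1ℤ + (-1ℤ + winding (x ∷ xs))                          ≡⟨ sym (+-assoc 1ℤ -1ℤ (winding (x ∷ xs))) ⟩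
  0ℤ + winding (x ∷ xs)                                  ≡⟨ +-identityˡ _ ⟩
  winding (x ∷ xs)                                       ∎
  where
  open ≡-Reasoning
  up : ∀ x → turn x (suc₃ x) ≡ 1ℤ
  up = from-yes (all? λ x → turn x (suc₃ x) ℤ.≟ 1ℤ)
  down : ∀ x → turn (suc₃ x) x ≡ -1ℤ
  down = from-yes (all? λ x → turn (suc₃ x) x ℤ.≟ -1ℤ)

pad-separated : ∀ {n} → Separated (suc n) → Separated (3 ℕ.+ n)
pad-separated (u , v , u-vertex , v-vertex , u-high , v-low) =
  pad u , pad v , pad-vertex u u-vertex , pad-vertex v v-vertex ,
  subst (+ 2 ℤ.≤_) (sym (winding-pad u)) u-high ,
  v-low ∘ subst (+ 2 ℤ.≤_) (winding-pad v)

consecDistinct? : ∀ {n} (w : Word n) → Dec (ConsecDistinct w)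
consecDistinct? []           = yes tt
consecDistinct? (x ∷ [])     = yes tt
consecDistinct? (x ∷ y ∷ ys) = ¬? (x ≟ y) ×-dec consecDistinct? (y ∷ ys)

isVertex? : ∀ {n} (w : Word n) → Dec (IsVertex w)
isVertex? []       = no λ ()
isVertex? (x ∷ xs) = consecDistinct? (x ∷ xs) ×-dec ¬? (x ≟ last (x ∷ xs))

separated-3 : Separated 3
separated-3 = u , v , from-yes (isVertex? u) , from-yes (isVertex? v) , +≤+ (s≤s (s≤s z≤n)) , λ ()
  where
  u v : Word 3
  u = 0F ∷ 1F ∷ 2F ∷ []
  v = 0F ∷ 2F ∷ 1F ∷ []

separated-6 : Separated 6
separated-6 = u , v , from-yes (isVertex? u) , from-yes (isVertex? v) , +≤+ (s≤s (s≤s z≤n)) , λ { (+≤+ (s≤s ())) }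
  where
  u v : Word 6
  u = 0F ∷ 1F ∷ 2F ∷ 0F ∷ 1F ∷ 2F ∷ []
  v = 0F ∷ 1F ∷ 2F ∷ 0F ∷ 2F ∷ 1F ∷ []

separated-5+ : ∀ m → Separated (5 ℕ.+ m)
separated-5+ 0             = pad-separated separated-3
separated-5+ 1             = separated-6
separated-5+ (suc (suc m)) = pad-separated (separated-5+ m)

arc? : ∀ {n} (u w : Word (suc n)) → Dec (Arc u w)
arc? (a ∷ as) w = isVertex? (a ∷ as) ×-dec isVertex? w ×-dec ≡-dec _≟_ as (init w)

-- Every arc out of a ∷ as ends in as ∷ʳ x for one of the three letters x.
walk? : ∀ {n} k (u v : Word (suc n)) → Dec (Walk u v k)
walk? zero    u        v = map′ (λ { refl → here }) (λ { here → refl }) (≡-dec _≟_ u v)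
walk? (suc k) (a ∷ as) v = map′ (λ (_ , arc , walk) → step arc walk) extend
  (any? λ x → arc? (a ∷ as) (as ∷ʳ x) ×-dec walk? k (as ∷ʳ x) v)
  where
  extend : Walk (a ∷ as) v (suc k) → ∃[ x ] (Arc (a ∷ as) (as ∷ʳ x) × Walk (as ∷ʳ x) v k)
  extend (step {w = w} arc walk) = last w , subst (λ w → Arc (a ∷ as) w × Walk w v k) (arc-target arc) (arc , walk)

walk≤? : ∀ {n} d (u v : Word (suc n)) → Dec (∃[ k ] (k ≤ d × Walk u v k))
walk≤? d u v = map′ (λ (k , k<1+d , walk) → k , m<1+n⇒m≤n k<1+d , walk)
                    (λ (k , k≤d , walk) → k , s≤s k≤d , walk)
                    (anyUpTo? (λ k → walk? k u v) (suc d))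

dist? : ∀ {n} d (u v : Word (suc n)) → Dec (Dist u v d)
dist? d u v = walk? d u v ×-dec map′ (λ noWalk k → noWalk {k}) (λ noWalk {k} → noWalk k)
                                     (allUpTo? (λ k → ¬? (walk? k u v)) d)

allWords? : ∀ {n} {P : Word n → Set} → (∀ w → Dec (P w)) → Dec (∀ w → P w)
allWords? {zero}  P? = map′ (λ p → λ { [] → p }) (λ ∀P → ∀P []) (P? [])
allWords? {suc n} P? = map′ (λ ∀P → λ { (x ∷ xs) → ∀P x xs }) (λ ∀P x xs → ∀P (x ∷ xs))
                            (all? λ x → allWords? λ xs → P? (x ∷ xs))

diameter≤? : ∀ {n} d → Dec (∀ (u v : Word (suc n)) → IsVertex u → IsVertex v → ∃[ k ] (k ≤ d × Walk u v k))
diameter≤? d = allWords? λ u → allWords? λ v → isVertex? u →-dec isVertex? v →-dec walk≤? d u v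

diameter-4 : DiameterIs 4 7
diameter-4 = from-yes (diameter≤? {3} 7) , u , v , from-yes (isVertex? u ×-dec isVertex? v ×-dec dist? 7 u v)
  where
  u v : Word 4
  u = 0F ∷ 1F ∷ 0F ∷ 2F ∷ []
  v = 2F ∷ 1F ∷ 0F ∷ 1F ∷ []

lemma8 : DiameterIs 4 7 × DiameterInfinite 3 × (∀ (ℓ : ℕ) → 5 ≤ ℓ → DiameterInfinite ℓ)
lemma8 = diameter-4 , separated⇒diameterInfinite separated-3 , infinite≥5
  where
  infinite≥5 : ∀ ℓ → 5 ≤ ℓ → DiameterInfinite ℓ
  infinite≥5 ℓ 5≤ℓ with m , refl ← m≤n⇒∃[o]m+o≡n 5≤ℓ = separated⇒diameterInfinite (separated-5+ m)
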